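{- For any $k\ge2$, the messy parallel $k$-signaletic operad and the messy series $k$-signaletic operad are not isomorphic.
   Context: $\mathbb{K}$ a field, $\mathcal{O}_k=\{\prec,\succ\}^k$ (binary operation symbols). Syntax trees on $\mathcal{O}_k$: planar binary trees with internal nodes labeled by $\mathcal{O}_k$, leaves numbered $1,\dots,n$ left to right; $\mathcal{F}(\mathcal{O}_k)$ the free non-symmetric operad spanned by syntax trees (composition by grafting). Parallel rule: $k$ cars start at the root and car $c_j$ follows at each internal node the $j$-th letter of its label ($\prec$: go to left child, $\succ$: right child) until reaching leaf $\ell_j$. Series rule: cars $c_1,\dots,c_k$ go one after the other; car $c_j$ reads at each node it reaches the leftmost letter of the label not yet erased by earlier cars, follows it, and erases it, ending at leaf $\ell_j$. $(\ell_1,\dots,\ell_k)$ is the parallel (resp. series) destination vector. The messy parallel (resp. series) $k$-signaletic operad is the quotient of $\mathcal{F}(\mathcal{O}_k)$ by the span (an operad ideal) of $s-t$ for all syntax trees $s,t$ of the same arity with the same parallel (resp. series) destination vector. -}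

module Defs where

open import Level using (Level; _⊔_; suc)
open import Data.Nat as ℕ using (ℕ; zero; suc; _+_; _∸_; _<_; _<ᵇ_)
open import Data.Bool using (Bool; true; false; if_then_else_)
open import Data.Fin using (Fin)
open import Data.Vec as V using (Vec; lookup; tabulate)
open import Data.Vec.Properties using (≡-dec)
open import Data.List as L using (List; []; _∷_; _++_; map; concatMap)
open import Data.List.Relation.Unary.All using (All)
open import Data.Product using (Σ; ∃; _×_; _,_; proj₁; proj₂)
open import Relation.Nullary using (¬_; Dec; yes; no)
open import Relation.Binary.PropositionalEquality using (_≡_; refl; cong; cong₂)
open import Algebra.Bundles using (CommutativeRing)

record Field (c ℓ : Level) : Set (Level.suc (c ⊔ ℓ)) where
  field
    commutativeRing : CommutativeRing c ℓ
  open CommutativeRing commutativeRing public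
  field
    0≉1     : ¬ (0# ≈ 1#)
    inverse : ∀ x → ¬ (x ≈ 0#) → ∃ λ y → (x * y) ≈ 1#

data Dir : Set where
  ≺ ≻ : Dir            -- ≺ : go to the left child, ≻ : go to the right child

_≟D_ : (a b : Dir) → Dec (a ≡ b)
≺ ≟D ≺ = yes refl
≺ ≟D ≻ = no λ ()
≻ ≟D ≺ = no λ ()
≻ ≟D ≻ = yes refl

Label : ℕ → Set
Label k = Vec Dir k

data Tree (k : ℕ) : Set where
  leaf : Tree k
  node : Label k → Tree k → Tree k → Tree k

arity : ∀ {k} → Tree k → ℕ
arity leaf         = 1
arity (node _ l r) = arity l + arity r

node-inj : ∀ {k} {a b : Label k} {l l' r r' : Tree k} →
           node a l r ≡ node b l' r' → (a ≡ b) × (l ≡ l') × (r ≡ r')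
node-inj refl = refl , refl , refl

_≟T_ : ∀ {k} (s t : Tree k) → Dec (s ≡ t)
leaf ≟T leaf = yes refl
leaf ≟T node _ _ _ = no λ ()
node _ _ _ ≟T leaf = no λ ()
node a l r ≟T node b l' r' with ≡-dec _≟D_ a b | l ≟T l' | r ≟T r'
... | yes refl | yes refl | yes refl = yes refl
... | no ¬p | _ | _ = no λ e → ¬p (proj₁ (node-inj e))
... | yes _ | no ¬p | _ = no λ e → ¬p (proj₁ (proj₂ (node-inj e)))
... | yes _ | yes _ | no ¬p = no λ e → ¬p (proj₂ (proj₂ (node-inj e)))

-- partial composition s ∘_i t (leaves numbered 0,1,...,arity s - 1 from the left):
-- graft t onto the i-th leaf of s
graft : ∀ {k} → Tree k → ℕ → Tree k → Tree k
graft leaf zero    t = t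
graft leaf (suc _) t = leaf
graft (node a l r) i t =
  if i <ᵇ arity l then node a (graft l i t) r
                  else node a l (graft r (i ∸ arity l) t)

-- Parallel rule: car j follows the j-th letter at every node.
parCar : ∀ {k} → Tree k → Fin k → ℕ
parCar leaf j = 0
parCar (node a l r) j with lookup a j
... | ≺ = parCar l j
... | ≻ = arity l + parCar r j

parDest : ∀ {k} → Tree k → Vec ℕ k
parDest t = tabulate (parCar t)

-- Series rule: labels are read as lists of not yet erased letters.
data ETree : Set where
  eleaf : ETree
  enode : List Dir → ETree → ETree → ETree

earity : ETree → ℕ
earity eleaf = 1
earity (enode _ l r) = earity l + earity r

toE : ∀ {k} → Tree k → ETree
toE leaf = eleaf
toE (node a l r) = enode (V.toList a) (toE l) (toE r)

-- one car drives: reads and erases the leftmost remaining letter at each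
-- node it reaches; returns its leaf and the tree with letters erased.
-- (The case of an empty label never occurs for the k cars on a tree of
--  O_k-labels; it is given an arbitrary value to make the function total.)
drive : ETree → ℕ × ETree
drive eleaf = 0 , eleaf
drive (enode [] l r) = 0 , enode [] l r
drive (enode (≺ ∷ ds) l r) with drive l
... | i , l' = i , enode ds l' r
drive (enode (≻ ∷ ds) l r) with drive r
... | i , r' = earity l + i , enode ds l r'

driveAll : (m : ℕ) → ETree → Vec ℕ m
driveAll zero    e = V.[]
driveAll (suc m) e with drive e
... | i , e' = i V.∷ driveAll m e'

serDest : ∀ {k} → Tree k → Vec ℕ k
serDest {k} t = driveAll k (toE t)

module Signaletic {c ℓ} (F : Field c ℓ) (k : ℕ) where
  open Field F using (Carrier; _≈_; 0#; 1#; -_) renaming (_+_ to _+K_; _*_ to _*K_; _-_ to _-K_)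

  -- formal K-linear combinations of syntax trees
  Comb : Set c
  Comb = List (Carrier × Tree k)

  Homog : ℕ → Comb → Set c
  Homog n x = All (λ p → arity (proj₂ p) ≡ n) x

  coeff : Comb → Tree k → Carrier
  coeff [] u = 0#
  coeff ((a , s) ∷ x) u with s ≟T u
  ... | yes _ = a +K coeff x u
  ... | no  _ = coeff x u

  _⊕_ : Comb → Comb → Comb
  x ⊕ y = x ++ y

  scale : Carrier → Comb → Comb
  scale a x = map (λ p → (a *K proj₁ p , proj₂ p)) x

  unit : Comb
  unit = (1# , leaf) ∷ []

  compose : Comb → ℕ → Comb → Comb
  compose x i y =
    concatMap (λ p → map (λ q → (proj₁ p *K proj₁ q , graft (proj₂ p) i (proj₂ q))) y) x

  -- Generators s - t of the ideal: triples (c, s, t), giving c·(s - t)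
  expand : List (Carrier × Tree k × Tree k) → Comb
  expand [] = []
  expand ((a , s , t) ∷ rs) = (a , s) ∷ (- a , t) ∷ expand rs

  -- x ≡ y in the quotient of F(O_k)(n) by the span of
  -- { s - t | arity s = arity t = n, D s = D t }
  record Rel (D : Tree k → Vec ℕ k) (n : ℕ) (x y : Comb) : Set (c ⊔ ℓ) where
    field
      gens    : List (Carrier × Tree k × Tree k)
      gens-ok : All (λ g → (arity (proj₁ (proj₂ g)) ≡ n) ×
                           (arity (proj₂ (proj₂ g)) ≡ n) ×
                           (D (proj₁ (proj₂ g)) ≡ D (proj₂ (proj₂ g)))) gens
      diff    : ∀ u → (coeff x u -K coeff y u) ≈ coeff (expand gens) u

  ParRel SerRel : ℕ → Comb → Comb → Set (c ⊔ ℓ)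
  ParRel = Rel parDest
  SerRel = Rel serDest

  record OperadIso (R₁ R₂ : ℕ → Comb → Comb → Set (c ⊔ ℓ)) : Set (c ⊔ ℓ) where
    field
      φ       : ℕ → Comb → Comb
      φ-homog : ∀ {n x} → Homog n x → Homog n (φ n x)
      φ-cong  : ∀ {n x y} → Homog n x → Homog n y → R₁ n x y → R₂ n (φ n x) (φ n y)
      φ-inj   : ∀ {n x y} → Homog n x → Homog n y → R₂ n (φ n x) (φ n y) → R₁ n x y
      φ-surj  : ∀ {n y} → Homog n y → Σ Comb λ x → Homog n x × R₂ n (φ n x) y
      φ-add   : ∀ {n x y} → Homog n x → Homog n y → R₂ n (φ n (x ⊕ y)) (φ n x ⊕ φ n y)
      φ-scale : ∀ {n} a {x} → Homog n x → R₂ n (φ n (scale a x)) (scale a (φ n x))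
      φ-unit  : R₂ 1 (φ 1 unit) unit
      φ-comp  : ∀ {m n x y} i → i < m → Homog m x → Homog n y →
                R₂ (m + n ∸ 1) (φ (m + n ∸ 1) (compose x i y))
                               (compose (φ m x) i (φ n y))

  MessyParallel≅MessySeries : Set (c ⊔ ℓ)
  MessyParallel≅MessySeries = OperadIso ParRel SerRel

-- In both quotients a combination of trees of arity n vanishes iff, for every destination
-- vector w, the coefficients of its trees with destination w sum to zero. In the parallel
-- operad this gives binary u, u′, y, y′ with u ∘₀ y = 0 = u′ ∘₀ y′ but u ∘₀ y′ ≠ 0 ≠ u′ ∘₀ y:
-- u, u′ are the cherries sending only car 0, resp. only car 1, to the left, and y, y′ are
-- differences of two cherries that disagree only in the letter of car 1, resp. car 0.
-- An isomorphism preserves and reflects zero composites, so this configuration would also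
-- exist in the series operad. There, the destination vector of a ∘₀ b determines a and exactly
-- the first #≺ a letters of b, so x ∘₀ y = 0 iff y vanishes after truncating labels to length
-- #≺ a, for every root label a in the support of x. These conditions only get stronger as
-- #≺ a grows, so the two crossed composites cannot both be nonzero.
module Submission where

open import Defs
open import Level using (Level)
open import Data.Nat using (ℕ; _≤_)
open import Relation.Nullary using (¬_)

open import Data.Bool using (if_then_else_)
open import Data.Empty using (⊥; ⊥-elim)
open import Data.Fin using (zero; suc)
open import Data.List using (List; []; _∷_; _++_; map)
open import Data.List.Membership.Propositional using (_∈_)
open import Data.List.Relation.Unary.All as All using (All; []; _∷_)
open import Data.List.Relation.Unary.All.Properties using (++⁺; map⁺)
open import Data.List.Relation.Unary.Any using (here; there)
open import Data.Nat as ℕ using (zero; suc; z≤n; s≤s)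
open import Data.Nat.Properties using (≤-total; ≤-trans; m≤m+n; +-mono-≤; <-irrefl)
open import Data.Product using (∃; _×_; _,_; proj₁; proj₂; map₁; map₂)
open import Data.Sum using (_⊎_; inj₁; inj₂)
open import Data.Vec as Vec using (Vec; []; _∷_; toList; lookup; replicate)
open import Data.Vec.Properties using (≡-dec; tabulate-cong; lookup∘tabulate)
open import Function using (_∘_)
open import Relation.Nullary using (Dec; yes; no; does; contradiction)
open import Relation.Nullary.Decidable using (_×-dec_; ¬?)
open import Relation.Binary.Definitions using (DecidableEquality)
open import Relation.Binary.PropositionalEquality
  using (_≡_; _≢_; refl; sym; trans; cong; subst; module ≡-Reasoning)

module LinearCombination {c ℓ} (F : Field c ℓ) where
  open Field F renaming (refl to ≈-refl; sym to ≈-sym; trans to ≈-trans)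
  open import Relation.Binary.Reasoning.Setoid setoid
  open import Algebra.Properties.Ring ring using (-‿distribˡ-*; x[y-z]≈xy-xz)
  open import Algebra.Properties.AbelianGroup +-abelianGroup using (⁻¹-∙-comm)
  open import Algebra.Properties.CommutativeSemigroup +-commutativeSemigroup using (interchange)
  open import Algebra.Properties.Group +-group using (ε⁻¹≈ε; x∙y⁻¹≈ε⇒x≈y; x≈y⇒x∙y⁻¹≈ε)

  ⟦_⟧ : ∀ {a} {A : Set a} → Dec A → Carrier
  ⟦ d ⟧ = if does d then 1# else 0#

  ⟦⟧-true : ∀ {a} {A : Set a} (d : Dec A) → A → ⟦ d ⟧ ≈ 1#
  ⟦⟧-true (yes _) _ = ≈-refl
  ⟦⟧-true (no ¬a) a = contradiction a ¬a

  ⟦⟧-false : ∀ {a} {A : Set a} (d : Dec A) → ¬ A → ⟦ d ⟧ ≈ 0#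
  ⟦⟧-false (yes a) ¬a = contradiction a ¬a
  ⟦⟧-false (no _) _ = ≈-refl

  ⟦⟧-⇔ : ∀ {a b} {A : Set a} {B : Set b} (d : Dec A) (e : Dec B) → (A → B) → (B → A) → ⟦ d ⟧ ≈ ⟦ e ⟧
  ⟦⟧-⇔ (yes a) e to _ = ≈-sym (⟦⟧-true e (to a))
  ⟦⟧-⇔ (no ¬a) e _ from = ≈-sym (⟦⟧-false e (¬a ∘ from))

  ⟦⟧-× : ∀ {a b} {A : Set a} {B : Set b} (d : Dec A) (e : Dec B) → ⟦ d ×-dec e ⟧ ≈ ⟦ d ⟧ * ⟦ e ⟧
  ⟦⟧-× (yes _) (yes _) = ≈-sym (*-identityʳ 1#)
  ⟦⟧-× (yes _) (no _) = ≈-sym (zeroʳ 1#)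
  ⟦⟧-× (no _) e = ≈-sym (zeroˡ ⟦ e ⟧)

  x*y≈0⇒y≈0 : ∀ {x y} → ¬ x ≈ 0# → x * y ≈ 0# → y ≈ 0#
  x*y≈0⇒y≈0 {x} {y} x≉0 xy≈0 with inverse x x≉0
  ... | x⁻¹ , xx⁻¹≈1 = begin
    y              ≈⟨ *-identityˡ y ⟨
    1# * y         ≈⟨ *-congʳ xx⁻¹≈1 ⟨
    (x * x⁻¹) * y  ≈⟨ *-congʳ (*-comm x x⁻¹) ⟩
    (x⁻¹ * x) * y  ≈⟨ *-assoc x⁻¹ x y ⟩
    x⁻¹ * (x * y)  ≈⟨ *-congˡ xy≈0 ⟩
    x⁻¹ * 0#       ≈⟨ zeroʳ x⁻¹ ⟩
    0#             ∎

  module _ {T : Set} where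
    pairing : List (Carrier × T) → (T → Carrier) → Carrier
    pairing [] f = 0#
    pairing ((a , t) ∷ x) f = a * f t + pairing x f

    negate : List (Carrier × T) → List (Carrier × T)
    negate = map (map₁ (λ a → - a))

    _⊖_ : List (Carrier × T) → List (Carrier × T) → List (Carrier × T)
    x ⊖ y = x ++ negate y

    pairing-congᴬ : ∀ x {f g} → All (λ p → f (proj₂ p) ≈ g (proj₂ p)) x → pairing x f ≈ pairing x g
    pairing-congᴬ [] [] = ≈-refl
    pairing-congᴬ ((a , t) ∷ x) (e ∷ es) = +-cong (*-congˡ e) (pairing-congᴬ x es)

    pairing-cong : ∀ x {f g} → (∀ t → f t ≈ g t) → pairing x f ≈ pairing x g
    pairing-cong x f≈g = pairing-congᴬ x (All.universal (f≈g ∘ proj₂) x)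

    pairing-zeroᴬ : ∀ x {f} → All (λ p → f (proj₂ p) ≈ 0#) x → pairing x f ≈ 0#
    pairing-zeroᴬ [] [] = ≈-refl
    pairing-zeroᴬ ((a , t) ∷ x) {f} (e ∷ es) = begin
      a * f t + pairing x f ≈⟨ +-cong (*-congˡ e) (pairing-zeroᴬ x es) ⟩
      a * 0# + 0#           ≈⟨ +-identityʳ (a * 0#) ⟩
      a * 0#                ≈⟨ zeroʳ a ⟩
      0#                    ∎

    pairing-zero : ∀ x {f} → (∀ t → f t ≈ 0#) → pairing x f ≈ 0#
    pairing-zero x f≈0 = pairing-zeroᴬ x (All.universal (f≈0 ∘ proj₂) x)

    pairing-+ : ∀ x f g → pairing x (λ t → f t + g t) ≈ pairing x f + pairing x g
    pairing-+ [] f g = ≈-sym (+-identityʳ 0#)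
    pairing-+ ((a , t) ∷ x) f g = begin
      a * (f t + g t) + pairing x (λ s → f s + g s)     ≈⟨ +-cong (distribˡ a (f t) (g t)) (pairing-+ x f g) ⟩
      (a * f t + a * g t) + (pairing x f + pairing x g) ≈⟨ interchange _ _ _ _ ⟩
      (a * f t + pairing x f) + (a * g t + pairing x g) ∎

    pairing-− : ∀ x f g → pairing x (λ t → f t - g t) ≈ pairing x f - pairing x g
    pairing-− [] f g = ≈-sym (≈-trans (+-congˡ ε⁻¹≈ε) (+-identityʳ 0#))
    pairing-− ((a , t) ∷ x) f g = begin
      a * (f t - g t) + pairing x (λ s → f s - g s)         ≈⟨ +-cong (x[y-z]≈xy-xz a (f t) (g t)) (pairing-− x f g) ⟩
      (a * f t - a * g t) + (pairing x f - pairing x g)     ≈⟨ interchange _ _ _ _ ⟩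
      (a * f t + pairing x f) + (- (a * g t) + - pairing x g) ≈⟨ +-congˡ (⁻¹-∙-comm _ _) ⟩
      (a * f t + pairing x f) - (a * g t + pairing x g)     ∎

    pairing-*ʳ : ∀ x f b → pairing x (λ t → f t * b) ≈ pairing x f * b
    pairing-*ʳ [] f b = ≈-sym (zeroˡ b)
    pairing-*ʳ ((a , t) ∷ x) f b = begin
      a * (f t * b) + pairing x (λ s → f s * b) ≈⟨ +-cong (≈-sym (*-assoc a (f t) b)) (pairing-*ʳ x f b) ⟩
      (a * f t) * b + pairing x f * b           ≈⟨ distribʳ b (a * f t) (pairing x f) ⟨
      (a * f t + pairing x f) * b               ∎

    pairing-++ : ∀ x y f → pairing (x ++ y) f ≈ pairing x f + pairing y f
    pairing-++ [] y f = ≈-sym (+-identityˡ (pairing y f))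
    pairing-++ ((a , t) ∷ x) y f = ≈-trans (+-congˡ (pairing-++ x y f)) (≈-sym (+-assoc _ _ _))

    pairing-negate : ∀ x f → pairing (negate x) f ≈ - pairing x f
    pairing-negate [] f = ≈-sym ε⁻¹≈ε
    pairing-negate ((a , t) ∷ x) f = begin
      - a * f t + pairing (negate x) f ≈⟨ +-cong (≈-sym (-‿distribˡ-* a (f t))) (pairing-negate x f) ⟩
      - (a * f t) + - pairing x f      ≈⟨ ⁻¹-∙-comm _ _ ⟩
      - (a * f t + pairing x f)        ∎

    pairing-⊖ : ∀ x y f → pairing (x ⊖ y) f ≈ pairing x f - pairing y f
    pairing-⊖ x y f = ≈-trans (pairing-++ x (negate y) f) (+-congˡ (pairing-negate y f))

  pairing-map₂ : ∀ {T U : Set} (g : T → U) x f → pairing (map (map₂ g) x) f ≡ pairing x (f ∘ g)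
  pairing-map₂ g [] f = refl
  pairing-map₂ g ((a , t) ∷ x) f = cong (a * f (g t) +_) (pairing-map₂ g x f)

  module Counting {T : Set} (_≟_ : DecidableEquality T) where
    count : List (Carrier × T) → T → Carrier
    count x t = pairing x (λ s → ⟦ s ≟ t ⟧)

    pairing≈0-fibrewise : ∀ x f → (∀ t → count x t * f t ≈ 0#) → pairing x f ≈ 0#
    pairing≈0-fibrewise [] f _ = ≈-refl
    pairing≈0-fibrewise ((a , t) ∷ x) f fibres≈0 = begin
      a * f t + pairing x f                                ≈⟨ +-congˡ (pairing-cong x split) ⟩
      a * f t + pairing x (λ s → ⟦ s ≟ t ⟧ * f t + f∖t s)  ≈⟨ +-congˡ (pairing-+ x _ _) ⟩
      a * f t + (pairing x (λ s → ⟦ s ≟ t ⟧ * f t) + pairing x f∖t)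
        ≈⟨ +-congˡ (+-cong (pairing-*ʳ x _ (f t)) (pairing≈0-fibrewise x f∖t rest≈0)) ⟩
      a * f t + (count x t * f t + 0#)                     ≈⟨ +-congˡ (+-identityʳ _) ⟩
      a * f t + count x t * f t                            ≈⟨ distribʳ (f t) a (count x t) ⟨
      (a + count x t) * f t                                ≈⟨ *-congʳ (+-congʳ a≈a⟦t≟t⟧) ⟩
      count ((a , t) ∷ x) t * f t                          ≈⟨ fibres≈0 t ⟩
      0#                                                   ∎
      where
      f∖t : T → Carrier
      f∖t s = ⟦ ¬? (s ≟ t) ⟧ * f s

      split : ∀ s → f s ≈ ⟦ s ≟ t ⟧ * f t + f∖t s
      split s with s ≟ t
      ... | yes refl = ≈-sym (≈-trans (+-cong (*-identityˡ (f s)) (zeroˡ (f s))) (+-identityʳ (f s)))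
      ... | no _ = ≈-sym (≈-trans (+-cong (zeroˡ (f t)) (*-identityˡ (f s))) (+-identityˡ (f s)))

      a≈a⟦t≟t⟧ : a ≈ a * ⟦ t ≟ t ⟧
      a≈a⟦t≟t⟧ = ≈-sym (≈-trans (*-congˡ (⟦⟧-true (t ≟ t) refl)) (*-identityʳ a))

      rest≈0 : ∀ s → count x s * f∖t s ≈ 0#
      rest≈0 s with s ≟ t
      ... | yes _ = ≈-trans (*-congˡ (zeroˡ (f s))) (zeroʳ (count x s))
      ... | no s≢t = begin
        count x s * (1# * f s)                        ≈⟨ *-cong (+-identityˡ (count x s)) (≈-sym (*-identityˡ (f s))) ⟨
        (0# + count x s) * f s                        ≈⟨ *-congʳ (+-congʳ (≈-trans (*-congˡ (⟦⟧-false (t ≟ s) (s≢t ∘ sym))) (zeroʳ a))) ⟨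
        count ((a , t) ∷ x) s * f s                   ≈⟨ fibres≈0 s ⟩
        0#                                            ∎

    pairing≈0-if-count≈0 : ∀ x f → (∀ t → count x t ≈ 0#) → pairing x f ≈ 0#
    pairing≈0-if-count≈0 x f count≈0 =
      pairing≈0-fibrewise x f (λ t → ≈-trans (*-congʳ (count≈0 t)) (zeroˡ (f t)))

    pairing-determined-by-count : ∀ x y → (∀ t → count x t ≈ count y t) → ∀ f → pairing x f ≈ pairing y f
    pairing-determined-by-count x y same f = x∙y⁻¹≈ε⇒x≈y _ _ (begin
      pairing x f - pairing y f ≈⟨ pairing-⊖ x y f ⟨
      pairing (x ⊖ y) f         ≈⟨ pairing≈0-if-count≈0 (x ⊖ y) f (λ t → ≈-trans (pairing-⊖ x y _) (x≈y⇒x∙y⁻¹≈ε (same t))) ⟩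
      0#                        ∎)

_≟V_ : ∀ {m} → DecidableEquality (Vec ℕ m)
_≟V_ = ≡-dec ℕ._≟_

module Quotient {c ℓ} (F : Field c ℓ) (k : ℕ) where
  open Field F renaming (refl to ≈-refl; sym to ≈-sym; trans to ≈-trans)
  open import Relation.Binary.Reasoning.Setoid setoid
  open import Algebra.Properties.Ring ring using (-‿distribˡ-*; x[y-z]≈xy-xz)
  open import Algebra.Properties.Group +-group using (ε⁻¹≈ε; x∙y⁻¹≈ε⇒x≈y; x≈y⇒x∙y⁻¹≈ε)
  open LinearCombination F
  open Counting (_≟T_ {k})
  open Signaletic F k

  Destinations : Set
  Destinations = Tree k → Vec ℕ k

  destinationSum : Destinations → Comb → Vec ℕ k → Carrier
  destinationSum D x w = pairing x (λ t → ⟦ D t ≟V w ⟧)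

  SameSums : Destinations → Comb → Comb → Set ℓ
  SameSums D x y = ∀ w → destinationSum D x w ≈ destinationSum D y w

  Generator : Set c
  Generator = Carrier × Tree k × Tree k

  Admissible : Destinations → ℕ → Generator → Set
  Admissible D n (_ , s , t) = arity s ≡ n × arity t ≡ n × D s ≡ D t

  coeff≈count : ∀ x u → coeff x u ≈ count x u
  coeff≈count [] u = ≈-refl
  coeff≈count ((a , s) ∷ x) u with s ≟T u
  ... | yes _ = +-cong (≈-sym (*-identityʳ a)) (coeff≈count x u)
  ... | no _ = ≈-trans (coeff≈count x u) (≈-sym (≈-trans (+-congʳ (zeroʳ a)) (+-identityˡ _)))

  pairing-expand : ∀ gs f → pairing (expand gs) f ≈ pairing gs (λ st → f (proj₁ st) - f (proj₂ st))
  pairing-expand [] f = ≈-refl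
  pairing-expand ((a , s , t) ∷ gs) f = begin
    a * f s + (- a * f t + pairing (expand gs) f)   ≈⟨ +-assoc _ _ _ ⟨
    (a * f s + - a * f t) + pairing (expand gs) f   ≈⟨ +-cong (+-congˡ (≈-sym (-‿distribˡ-* a (f t)))) (pairing-expand gs f) ⟩
    (a * f s + - (a * f t)) + pairing gs _          ≈⟨ +-congʳ (x[y-z]≈xy-xz a (f s) (f t)) ⟨
    a * (f s - f t) + pairing gs _                  ∎

  destinationSum-expand : ∀ D {n} gs → All (Admissible D n) gs → ∀ w → destinationSum D (expand gs) w ≈ 0#
  destinationSum-expand D gs admissible w =
    ≈-trans (pairing-expand gs δ) (pairing-zeroᴬ gs (All.map (λ { (_ , _ , Ds≡Dt) → x≈y⇒x∙y⁻¹≈ε (reflexive (cong (λ v → ⟦ v ≟V w ⟧) Ds≡Dt)) }) admissible))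
    where
    δ : Tree k → Carrier
    δ t = ⟦ D t ≟V w ⟧

  Rel⇒SameSums : ∀ {D n x y} → Rel D n x y → SameSums D x y
  Rel⇒SameSums {D} {n} {x} {y} r w = x∙y⁻¹≈ε⇒x≈y _ _ (begin
    destinationSum D x w - destinationSum D y w ≈⟨ pairing-⊖ x y _ ⟨
    pairing (x ⊖ y) _                           ≈⟨ pairing-determined-by-count (x ⊖ y) (expand gens) same-count _ ⟩
    destinationSum D (expand gens) w            ≈⟨ destinationSum-expand D gens gens-ok w ⟩
    0#                                          ∎)
    where
    open Rel r
    same-count : ∀ u → count (x ⊖ y) u ≈ count (expand gens) u
    same-count u = begin
      count (x ⊖ y) u             ≈⟨ pairing-⊖ x y _ ⟩
      count x u - count y u       ≈⟨ +-cong (coeff≈count x u) (-‿cong (coeff≈count y u)) ⟨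
      coeff x u - coeff y u       ≈⟨ diff u ⟩
      coeff (expand gens) u       ≈⟨ coeff≈count (expand gens) u ⟩
      count (expand gens) u       ∎

  module _ (D : Destinations) where
    representative : Comb → Vec ℕ k → Tree k
    representative [] w = leaf
    representative ((_ , s) ∷ z) w with D s ≟V w
    ... | yes _ = s
    ... | no _ = representative z w

    representative-correct : ∀ {n z a t} → Homog n z → (a , t) ∈ z →
      arity (representative z (D t)) ≡ n × D (representative z (D t)) ≡ D t
    representative-correct {z = (_ , s) ∷ z} {t = t} (ns ∷ nz) at∈z with D s ≟V D t | at∈z
    ... | yes Ds≡Dt | _ = ns , Ds≡Dt
    ... | no Ds≢Dt | here refl = ⊥-elim (Ds≢Dt refl)
    ... | no _ | there at∈z′ = representative-correct nz at∈z′

    representative-pairing≈0 : ∀ {n} z → Homog n z → (∀ w → destinationSum D z w ≈ 0#) →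
      ∀ u → pairing z (λ t → ⟦ representative z (D t) ≟T u ⟧) ≈ 0#
    representative-pairing≈0 z hz z≈0 u = begin
      pairing z (λ t → ⟦ rep t ≟T u ⟧)                    ≈⟨ pairing-congᴬ z (All.tabulate factorise) ⟩
      pairing z (λ t → ⟦ D t ≟V D u ⟧ * ⟦ u ≟T rep u ⟧)  ≈⟨ pairing-*ʳ z _ _ ⟩
      destinationSum D z (D u) * ⟦ u ≟T rep u ⟧          ≈⟨ *-congʳ (z≈0 (D u)) ⟩
      0# * ⟦ u ≟T rep u ⟧                                ≈⟨ zeroˡ _ ⟩
      0#                                                 ∎
      where
      rep : Tree k → Tree k
      rep t = representative z (D t)

      factorise : ∀ {a t} → (a , t) ∈ z → ⟦ rep t ≟T u ⟧ ≈ ⟦ D t ≟V D u ⟧ * ⟦ u ≟T rep u ⟧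
      factorise {t = t} at∈z = ≈-trans (⟦⟧-⇔ (rep t ≟T u) ((D t ≟V D u) ×-dec (u ≟T rep u)) to from)
                                       (⟦⟧-× (D t ≟V D u) (u ≟T rep u))
        where
        Drep≡D : D (rep t) ≡ D t
        Drep≡D = proj₂ (representative-correct hz at∈z)
        to : rep t ≡ u → D t ≡ D u × u ≡ rep u
        to refl = sym Drep≡D , cong (representative z) (sym Drep≡D)
        from : D t ≡ D u × u ≡ rep u → rep t ≡ u
        from (Dt≡Du , u≡rep) = trans (cong (representative z) Dt≡Du) (sym u≡rep)

    -- Each term a·t of x − y is rewritten as a·(t − rep t) + a·rep t, where rep t is the first
    -- tree of x − y with the destination of t; the terms a·rep t cancel since x − y has zero sums.
    SameSums⇒Rel : ∀ {n x y} → Homog n x → Homog n y → SameSums D x y → Rel D n x y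
    SameSums⇒Rel {n} {x} {y} hx hy same = record { gens = gens ; gens-ok = admissible ; diff = diff }
      where
      z : Comb
      z = x ⊖ y

      hz : Homog n z
      hz = ++⁺ hx (map⁺ hy)

      rep : Tree k → Tree k
      rep t = representative z (D t)

      gens : List Generator
      gens = map (map₂ (λ t → t , rep t)) z

      admissible : All (Admissible D n) gens
      admissible = map⁺ (All.tabulate λ at∈z →
        All.lookup hz at∈z , proj₁ (representative-correct hz at∈z) , sym (proj₂ (representative-correct hz at∈z)))

      rep-pairing≈0 : ∀ u → pairing z (λ t → ⟦ rep t ≟T u ⟧) ≈ 0#
      rep-pairing≈0 = representative-pairing≈0 z hz λ w → ≈-trans (pairing-⊖ x y _) (x≈y⇒x∙y⁻¹≈ε (same w))

      diff : ∀ u → coeff x u - coeff y u ≈ coeff (expand gens) u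
      diff u = begin
        coeff x u - coeff y u                               ≈⟨ +-cong (coeff≈count x u) (-‿cong (coeff≈count y u)) ⟩
        count x u - count y u                               ≈⟨ pairing-⊖ x y _ ⟨
        count z u                                           ≈⟨ +-identityʳ _ ⟨
        count z u + 0#                                      ≈⟨ +-congˡ (≈-trans (-‿cong (rep-pairing≈0 u)) ε⁻¹≈ε) ⟨
        count z u - pairing z (λ t → ⟦ rep t ≟T u ⟧)        ≈⟨ pairing-− z _ _ ⟨
        pairing z (λ t → ⟦ t ≟T u ⟧ - ⟦ rep t ≟T u ⟧)       ≡⟨ pairing-map₂ (λ t → t , rep t) z _ ⟨
        pairing gens (λ st → ⟦ proj₁ st ≟T u ⟧ - ⟦ proj₂ st ≟T u ⟧) ≈⟨ pairing-expand gens _ ⟨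
        count (expand gens) u                               ≈⟨ coeff≈count (expand gens) u ⟨
        coeff (expand gens) u                               ∎

cherry : ∀ {k} → Label k → Tree k
cherry a = node a leaf leaf

1≤arity : ∀ {k} (t : Tree k) → 1 ≤ arity t
1≤arity leaf = s≤s z≤n
1≤arity (node _ l r) = ≤-trans (1≤arity l) (m≤m+n (arity l) (arity r))

2≤arity-node : ∀ {k} a (l r : Tree k) → 2 ≤ arity (node a l r)
2≤arity-node a l r = +-mono-≤ (1≤arity l) (1≤arity r)

arity≡2⇒cherry : ∀ {k} (t : Tree k) → arity t ≡ 2 → ∃ λ a → t ≡ cherry a
arity≡2⇒cherry (node a leaf leaf) _ = a , refl
arity≡2⇒cherry (node a leaf (node b l r)) e =
  ⊥-elim (<-irrefl refl (subst (3 ≤_) e (s≤s (2≤arity-node b l r))))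
arity≡2⇒cherry (node a (node b l r) r′) e =
  ⊥-elim (<-irrefl refl (subst (3 ≤_) e (+-mono-≤ (2≤arity-node b l r) (1≤arity r′))))

leafOf : Dir → ℕ
leafOf ≺ = 0
leafOf ≻ = 1

module Differences {c ℓ} (F : Field c ℓ) (k : ℕ) where
  open Field F renaming (refl to ≈-refl; sym to ≈-sym; trans to ≈-trans)
  open import Relation.Binary.Reasoning.Setoid setoid
  open import Algebra.Properties.Ring ring using (-1*x≈-x)
  open import Algebra.Properties.Group +-group using (ε⁻¹≈ε; x≈y⇒x∙y⁻¹≈ε)
  open LinearCombination F
  open Signaletic F k
  open Quotient F k

  ⟨_⟩ : Label k → Comb
  ⟨ a ⟩ = (1# , cherry a) ∷ []

  _⟨−⟩_ : Label k → Label k → Comb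
  a ⟨−⟩ b = (1# , cherry a) ∷ (- 1# , cherry b) ∷ []

  module _ (D : Destinations) (r L L′ : Label k) where
    private
      s s′ : Tree k
      s = node r (cherry L) leaf
      s′ = node r (cherry L′) leaf

    destinationSum-∘₀⟨−⟩ : ∀ w → destinationSum D (compose ⟨ r ⟩ 0 (L ⟨−⟩ L′)) w ≈ ⟦ D s ≟V w ⟧ - ⟦ D s′ ≟V w ⟧
    destinationSum-∘₀⟨−⟩ w = begin
      (1# * 1#) * ⟦ D s ≟V w ⟧ + ((1# * - 1#) * ⟦ D s′ ≟V w ⟧ + 0#)
        ≈⟨ +-congˡ (+-identityʳ _) ⟩
      (1# * 1#) * ⟦ D s ≟V w ⟧ + (1# * - 1#) * ⟦ D s′ ≟V w ⟧
        ≈⟨ +-cong (*-congʳ (*-identityˡ 1#)) (*-congʳ (*-identityˡ (- 1#))) ⟩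
      1# * ⟦ D s ≟V w ⟧ + - 1# * ⟦ D s′ ≟V w ⟧
        ≈⟨ +-cong (*-identityˡ _) (-1*x≈-x _) ⟩
      ⟦ D s ≟V w ⟧ - ⟦ D s′ ≟V w ⟧ ∎

    ∘₀⟨−⟩≈0 : D s ≡ D s′ → Rel D 3 (compose ⟨ r ⟩ 0 (L ⟨−⟩ L′)) []
    ∘₀⟨−⟩≈0 Ds≡Ds′ = SameSums⇒Rel D (refl ∷ refl ∷ []) [] λ w →
      ≈-trans (destinationSum-∘₀⟨−⟩ w) (x≈y⇒x∙y⁻¹≈ε (reflexive (cong (λ v → ⟦ v ≟V w ⟧) Ds≡Ds′)))

    ∘₀⟨−⟩≉0 : D s ≢ D s′ → ¬ Rel D 3 (compose ⟨ r ⟩ 0 (L ⟨−⟩ L′)) []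
    ∘₀⟨−⟩≉0 Ds≢Ds′ rel = 0≉1 (begin
      0#                                            ≈⟨ Rel⇒SameSums rel (D s) ⟨
      destinationSum D (compose ⟨ r ⟩ 0 (L ⟨−⟩ L′)) (D s) ≈⟨ destinationSum-∘₀⟨−⟩ (D s) ⟩
      ⟦ D s ≟V D s ⟧ - ⟦ D s′ ≟V D s ⟧             ≈⟨ +-cong (⟦⟧-true (D s ≟V D s) refl) (-‿cong (⟦⟧-false (D s′ ≟V D s) (Ds≢Ds′ ∘ sym))) ⟩
      1# - 0#                                       ≈⟨ +-congˡ ε⁻¹≈ε ⟩
      1# + 0#                                       ≈⟨ +-identityʳ 1# ⟩
      1#                                            ∎)

leafOf-injective : ∀ {d d′} → leafOf d ≡ leafOf d′ → d ≡ d′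
leafOf-injective {≺} {≺} _ = refl
leafOf-injective {≻} {≻} _ = refl

parCar-cherry : ∀ {k} (L : Label k) j → parCar (cherry L) j ≡ leafOf (lookup L j)
parCar-cherry L j with lookup L j
... | ≺ = refl
... | ≻ = refl

parCar-∘₀ : ∀ {k} (r L : Label k) j → lookup r j ≡ ≺ → parCar (node r (cherry L) leaf) j ≡ leafOf (lookup L j)
parCar-∘₀ r L j r≺ rewrite r≺ = parCar-cherry L j

parDest-∘₀-agree : ∀ {k} (r L L′ : Label k) → (∀ j → lookup r j ≡ ≺ → lookup L j ≡ lookup L′ j) →
  parDest (node r (cherry L) leaf) ≡ parDest (node r (cherry L′) leaf)
parDest-∘₀-agree r L L′ agree = tabulate-cong car
  where
  car : ∀ j → parCar (node r (cherry L) leaf) j ≡ parCar (node r (cherry L′) leaf) j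
  car j with lookup r j in r≺
  ... | ≻ = refl
  ... | ≺ = trans (parCar-cherry L j) (trans (cong leafOf (agree j r≺)) (sym (parCar-cherry L′ j)))

parDest-∘₀-differ : ∀ {k} (r L L′ : Label k) j → lookup r j ≡ ≺ → lookup L j ≢ lookup L′ j →
  parDest (node r (cherry L) leaf) ≢ parDest (node r (cherry L′) leaf)
parDest-∘₀-differ r L L′ j r≺ L≢L′ same = L≢L′ (leafOf-injective (begin
  leafOf (lookup L j)                            ≡⟨ parCar-∘₀ r L j r≺ ⟨
  parCar (node r (cherry L) leaf) j              ≡⟨ lookup∘tabulate _ j ⟨
  lookup (parDest (node r (cherry L) leaf)) j    ≡⟨ cong (λ v → lookup v j) same ⟩
  lookup (parDest (node r (cherry L′) leaf)) j   ≡⟨ lookup∘tabulate _ j ⟩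
  parCar (node r (cherry L′) leaf) j             ≡⟨ parCar-∘₀ r L′ j r≺ ⟩
  leafOf (lookup L′ j)                           ∎))
  where open ≡-Reasoning

module ParallelWitnesses (k′ : ℕ) where
  all≺ only₀≺ only₁≺ only₀≻ only₁≻ : Label (suc (suc k′))
  all≺ = ≺ ∷ ≺ ∷ replicate k′ ≺
  only₀≺ = ≺ ∷ ≻ ∷ replicate k′ ≻
  only₁≺ = ≻ ∷ ≺ ∷ replicate k′ ≻
  only₀≻ = ≻ ∷ ≺ ∷ replicate k′ ≺
  only₁≻ = ≺ ∷ ≻ ∷ replicate k′ ≺

  only₀≺-ignores-car₁ : parDest (node only₀≺ (cherry all≺) leaf) ≡ parDest (node only₀≺ (cherry only₁≻) leaf)
  only₀≺-ignores-car₁ = parDest-∘₀-agree only₀≺ all≺ only₁≻ λ where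
    zero _ → refl
    (suc zero) ()
    (suc (suc _)) _ → refl

  only₁≺-ignores-car₀ : parDest (node only₁≺ (cherry all≺) leaf) ≡ parDest (node only₁≺ (cherry only₀≻) leaf)
  only₁≺-ignores-car₀ = parDest-∘₀-agree only₁≺ all≺ only₀≻ λ where
    zero ()
    (suc zero) _ → refl
    (suc (suc _)) _ → refl

  only₀≺-sees-car₀ : parDest (node only₀≺ (cherry all≺) leaf) ≢ parDest (node only₀≺ (cherry only₀≻) leaf)
  only₀≺-sees-car₀ = parDest-∘₀-differ only₀≺ all≺ only₀≻ zero refl λ ()

  only₁≺-sees-car₁ : parDest (node only₁≺ (cherry all≺) leaf) ≢ parDest (node only₁≺ (cherry only₁≻) leaf)
  only₁≺-sees-car₁ = parDest-∘₀-differ only₁≺ all≺ only₁≻ (suc zero) refl λ ()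

#≺ : ∀ {m} → Vec Dir m → ℕ
#≺ [] = 0
#≺ (≺ ∷ a) = suc (#≺ a)
#≺ (≻ ∷ a) = #≺ a

-- An exhausted b is read as ≺, as `drive` does on an empty label; this never happens when b is
-- at least as long as a.
serDest∘₀ : ∀ {m} → Vec Dir m → List Dir → Vec ℕ m
serDest∘₀ [] bs = []
serDest∘₀ (≻ ∷ a) bs = 2 ∷ serDest∘₀ a bs
serDest∘₀ (≺ ∷ a) [] = 0 ∷ serDest∘₀ a []
serDest∘₀ (≺ ∷ a) (b ∷ bs) = leafOf b ∷ serDest∘₀ a bs

driveAll-∘₀ : ∀ {m} (a : Vec Dir m) bs →
  driveAll m (enode (toList a) (enode bs eleaf eleaf) eleaf) ≡ serDest∘₀ a bs
driveAll-∘₀ [] bs = refl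
driveAll-∘₀ (≻ ∷ a) bs = cong (2 ∷_) (driveAll-∘₀ a bs)
driveAll-∘₀ (≺ ∷ a) [] = cong (0 ∷_) (driveAll-∘₀ a [])
driveAll-∘₀ (≺ ∷ a) (≺ ∷ bs) = cong (0 ∷_) (driveAll-∘₀ a bs)
driveAll-∘₀ (≺ ∷ a) (≻ ∷ bs) = cong (1 ∷_) (driveAll-∘₀ a bs)

rootDir : ℕ → Dir
rootDir 2 = ≻
rootDir _ = ≺

rootLabel : ∀ {m} → Vec ℕ m → Vec Dir m
rootLabel = Vec.map rootDir

rootLabel-serDest∘₀ : ∀ {m} (a : Vec Dir m) bs → rootLabel (serDest∘₀ a bs) ≡ a
rootLabel-serDest∘₀ [] bs = refl
rootLabel-serDest∘₀ (≻ ∷ a) bs = cong (≻ ∷_) (rootLabel-serDest∘₀ a bs)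
rootLabel-serDest∘₀ (≺ ∷ a) [] = cong (≺ ∷_) (rootLabel-serDest∘₀ a [])
rootLabel-serDest∘₀ (≺ ∷ a) (≺ ∷ bs) = cong (≺ ∷_) (rootLabel-serDest∘₀ a bs)
rootLabel-serDest∘₀ (≺ ∷ a) (≻ ∷ bs) = cong (≺ ∷_) (rootLabel-serDest∘₀ a bs)

prefix : ℕ → List Dir → List Dir
prefix zero bs = []
prefix (suc n) [] = ≺ ∷ prefix n []
prefix (suc n) (b ∷ bs) = b ∷ prefix n bs

prefix-prefix : ∀ {m m′} → m ≤ m′ → ∀ bs → prefix m (prefix m′ bs) ≡ prefix m bs
prefix-prefix z≤n bs = refl
prefix-prefix (s≤s m≤m′) [] = cong (≺ ∷_) (prefix-prefix m≤m′ [])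
prefix-prefix (s≤s m≤m′) (b ∷ bs) = cong (b ∷_) (prefix-prefix m≤m′ bs)

serDest∘₀-prefix : ∀ {m} (a : Vec Dir m) bs → serDest∘₀ a bs ≡ serDest∘₀ a (prefix (#≺ a) bs)
serDest∘₀-prefix [] bs = refl
serDest∘₀-prefix (≻ ∷ a) bs = cong (2 ∷_) (serDest∘₀-prefix a bs)
serDest∘₀-prefix (≺ ∷ a) [] = cong (0 ∷_) (serDest∘₀-prefix a [])
serDest∘₀-prefix (≺ ∷ a) (b ∷ bs) = cong (leafOf b ∷_) (serDest∘₀-prefix a bs)

readLetters : ∀ {m} → Vec ℕ m → List Dir
readLetters [] = []
readLetters (0 ∷ v) = ≺ ∷ readLetters v
readLetters (2 ∷ v) = readLetters v
readLetters (_ ∷ v) = ≻ ∷ readLetters v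

readLetters-serDest∘₀ : ∀ {m} (a : Vec Dir m) bs → readLetters (serDest∘₀ a bs) ≡ prefix (#≺ a) bs
readLetters-serDest∘₀ [] bs = refl
readLetters-serDest∘₀ (≻ ∷ a) bs = readLetters-serDest∘₀ a bs
readLetters-serDest∘₀ (≺ ∷ a) [] = cong (≺ ∷_) (readLetters-serDest∘₀ a [])
readLetters-serDest∘₀ (≺ ∷ a) (≺ ∷ bs) = cong (≺ ∷_) (readLetters-serDest∘₀ a bs)
readLetters-serDest∘₀ (≺ ∷ a) (≻ ∷ bs) = cong (≻ ∷_) (readLetters-serDest∘₀ a bs)

serDest∘₀-factors : ∀ {m} (a a′ : Vec Dir m) → #≺ a ≤ #≺ a′ → ∀ bs →
  serDest∘₀ a bs ≡ serDest∘₀ a (readLetters (serDest∘₀ a′ bs))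
serDest∘₀-factors a a′ a≤a′ bs = begin
  serDest∘₀ a bs                                           ≡⟨ serDest∘₀-prefix a bs ⟩
  serDest∘₀ a (prefix (#≺ a) bs)                           ≡⟨ cong (serDest∘₀ a) (prefix-prefix a≤a′ bs) ⟨
  serDest∘₀ a (prefix (#≺ a) (prefix (#≺ a′) bs))          ≡⟨ cong (serDest∘₀ a ∘ prefix (#≺ a)) (readLetters-serDest∘₀ a′ bs) ⟨
  serDest∘₀ a (prefix (#≺ a) (readLetters (serDest∘₀ a′ bs))) ≡⟨ serDest∘₀-prefix a _ ⟨
  serDest∘₀ a (readLetters (serDest∘₀ a′ bs))              ∎
  where open ≡-Reasoning

¬¬-∀-Vec : ∀ {p} m {P : Vec Dir m → Set p} → (∀ a → ¬ ¬ P a) → ¬ ¬ (∀ a → P a)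
¬¬-∀-Vec zero ¬¬P ¬∀P = ¬¬P [] (λ P[] → ¬∀P λ { [] → P[] })
¬¬-∀-Vec (suc m) ¬¬P ¬∀P =
  ¬¬-∀-Vec m (λ a → ¬¬P (≺ ∷ a)) λ P≺ →
  ¬¬-∀-Vec m (λ a → ¬¬P (≻ ∷ a)) λ P≻ →
  ¬∀P λ { (≺ ∷ a) → P≺ a ; (≻ ∷ a) → P≻ a }

¬∀⇒¬¬∃¬-Vec : ∀ {p} m {P : Vec Dir m → Set p} → ¬ (∀ a → P a) → ¬ ¬ (∃ λ a → ¬ P a)
¬∀⇒¬¬∃¬-Vec m ¬∀P ¬∃¬P = ¬¬-∀-Vec m (λ a ¬Pa → ¬∃¬P (a , ¬Pa)) ¬∀P

module SeriesArity2 {c ℓ} (F : Field c ℓ) (k : ℕ) where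
  open Field F renaming (refl to ≈-refl; sym to ≈-sym; trans to ≈-trans)
  open import Relation.Binary.Reasoning.Setoid setoid
  open LinearCombination F

  _≟L_ : DecidableEquality (Label k)
  _≟L_ = ≡-dec _≟D_

  open Counting _≟L_ using (count; pairing≈0-fibrewise)
  private module ByDestination = Counting (_≟V_ {k})

  LabelComb : Set c
  LabelComb = List (Carrier × Label k)

  destSum∘₀ : Label k → LabelComb → Vec ℕ k → Carrier
  destSum∘₀ a ys w = pairing ys (λ b → ⟦ serDest∘₀ a (toList b) ≟V w ⟧)

  _∘₀_≈0 : LabelComb → LabelComb → Set ℓ
  xs ∘₀ ys ≈0 = ∀ w → pairing xs (λ a → destSum∘₀ a ys w) ≈ 0#

  [_]∘₀_≈0 : Label k → LabelComb → Set ℓ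
  [ a ]∘₀ ys ≈0 = ∀ w → destSum∘₀ a ys w ≈ 0#

  destSum∘₀-offRoot : ∀ a ys w → a ≢ rootLabel w → destSum∘₀ a ys w ≈ 0#
  destSum∘₀-offRoot a ys w a≢root = pairing-zero ys λ b →
    ⟦⟧-false (serDest∘₀ a (toList b) ≟V w) λ e →
      a≢root (trans (sym (rootLabel-serDest∘₀ a (toList b))) (cong rootLabel e))

  ∘₀≈0⇒[]∘₀≈0 : ∀ xs ys → xs ∘₀ ys ≈0 → ∀ a → ¬ count xs a ≈ 0# → [ a ]∘₀ ys ≈0
  ∘₀≈0⇒[]∘₀≈0 xs ys xs∘ys≈0 a count≉0 w with a ≟L rootLabel w
  ... | no a≢root = destSum∘₀-offRoot a ys w a≢root
  ... | yes refl = x*y≈0⇒y≈0 count≉0 (begin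
    count xs a * destSum∘₀ a ys w                       ≈⟨ pairing-*ʳ xs _ _ ⟨
    pairing xs (λ a′ → ⟦ a′ ≟L a ⟧ * destSum∘₀ a ys w)  ≈⟨ pairing-cong xs only-a ⟨
    pairing xs (λ a′ → destSum∘₀ a′ ys w)               ≈⟨ xs∘ys≈0 w ⟩
    0#                                                  ∎)
    where
    only-a : ∀ a′ → destSum∘₀ a′ ys w ≈ ⟦ a′ ≟L a ⟧ * destSum∘₀ a ys w
    only-a a′ with a′ ≟L a
    ... | yes refl = ≈-sym (*-identityˡ _)
    ... | no a′≢a = ≈-trans (destSum∘₀-offRoot a′ ys w a′≢a) (≈-sym (zeroˡ _))

  []∘₀≈0⇒∘₀≈0 : ∀ xs ys → (∀ a → count xs a ≈ 0# ⊎ [ a ]∘₀ ys ≈0) → xs ∘₀ ys ≈0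
  []∘₀≈0⇒∘₀≈0 xs ys count≈0-or-[a]∘ys≈0 w = pairing≈0-fibrewise xs _ fibre
    where
    fibre : ∀ a → count xs a * destSum∘₀ a ys w ≈ 0#
    fibre a with count≈0-or-[a]∘ys≈0 a
    ... | inj₁ count≈0 = ≈-trans (*-congʳ count≈0) (zeroˡ _)
    ... | inj₂ a∘ys≈0 = ≈-trans (*-congˡ (a∘ys≈0 w)) (zeroʳ _)

  []∘₀≈0-anti : ∀ ys a a′ → #≺ a ≤ #≺ a′ → [ a′ ]∘₀ ys ≈0 → [ a ]∘₀ ys ≈0
  []∘₀≈0-anti ys a a′ a≤a′ a′∘ys≈0 w = begin
    destSum∘₀ a ys w
      ≈⟨ pairing-cong ys (λ b → reflexive (cong (λ v → ⟦ v ≟V w ⟧) (serDest∘₀-factors a a′ a≤a′ (toList b)))) ⟩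
    pairing ys (λ b → ⟦ serDest∘₀ a (readLetters (through b)) ≟V w ⟧)
      ≡⟨ pairing-map₂ through ys _ ⟨
    pairing (map (map₂ through) ys) (λ v → ⟦ serDest∘₀ a (readLetters v) ≟V w ⟧)
      ≈⟨ ByDestination.pairing≈0-if-count≈0 (map (map₂ through) ys) _
           (λ v → ≈-trans (reflexive (pairing-map₂ through ys (λ u → ⟦ u ≟V v ⟧))) (a′∘ys≈0 v)) ⟩
    0# ∎
    where
    through : Label k → Vec ℕ k
    through b = serDest∘₀ a′ (toList b)

  -- Equality in F is undecidable, so the supports of xs and xs′ are not computable; the witnesses
  -- a, a′ are chosen under double negation, which suffices for a proof of ⊥.
  no-crossed-zero-composites : ∀ {xs xs′ ys ys′} →
    xs ∘₀ ys ≈0 → xs′ ∘₀ ys′ ≈0 → ¬ xs ∘₀ ys′ ≈0 → ¬ xs′ ∘₀ ys ≈0 → ⊥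
  no-crossed-zero-composites {xs} {xs′} {ys} {ys′} xs∘ys≈0 xs′∘ys′≈0 xs∘ys′≉0 xs′∘ys≉0 =
    ¬∀⇒¬¬∃¬-Vec k (xs∘ys′≉0 ∘ []∘₀≈0⇒∘₀≈0 xs ys′) λ (a , a-bad) →
    ¬∀⇒¬¬∃¬-Vec k (xs′∘ys≉0 ∘ []∘₀≈0⇒∘₀≈0 xs′ ys) λ (a′ , a′-bad) →
    by-comparison a a′ a-bad a′-bad (≤-total (#≺ a) (#≺ a′))
    where
    by-comparison : ∀ a a′ → ¬ (count xs a ≈ 0# ⊎ [ a ]∘₀ ys′ ≈0) → ¬ (count xs′ a′ ≈ 0# ⊎ [ a′ ]∘₀ ys ≈0) →
              #≺ a ≤ #≺ a′ ⊎ #≺ a′ ≤ #≺ a → ⊥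
    by-comparison a a′ a-bad a′-bad (inj₁ a≤a′) =
      a-bad (inj₂ ([]∘₀≈0-anti ys′ a a′ a≤a′ (∘₀≈0⇒[]∘₀≈0 xs′ ys′ xs′∘ys′≈0 a′ (a′-bad ∘ inj₁))))
    by-comparison a a′ a-bad a′-bad (inj₂ a′≤a) =
      a′-bad (inj₂ ([]∘₀≈0-anti ys a′ a a′≤a (∘₀≈0⇒[]∘₀≈0 xs ys xs∘ys≈0 a (a-bad ∘ inj₁))))

module SeriesTrees {c ℓ} (F : Field c ℓ) (k : ℕ) where
  open Field F renaming (refl to ≈-refl; sym to ≈-sym; trans to ≈-trans)
  open import Relation.Binary.Reasoning.Setoid setoid
  open LinearCombination F
  open Signaletic F k
  open Quotient F k using (destinationSum)
  open SeriesArity2 F k using (LabelComb; destSum∘₀)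

  rootOf : Tree k → Label k
  rootOf leaf = replicate k ≺  -- junk value: only applied to trees of arity 2
  rootOf (node a _ _) = a

  labels : Comb → LabelComb
  labels = map (map₂ rootOf)

  serDest-graft₀ : ∀ {s t} → arity s ≡ 2 → arity t ≡ 2 →
    serDest (graft s 0 t) ≡ serDest∘₀ (rootOf s) (toList (rootOf t))
  serDest-graft₀ {s} {t} s-binary t-binary with arity≡2⇒cherry s s-binary | arity≡2⇒cherry t t-binary
  ... | a , refl | b , refl = driveAll-∘₀ a (toList b)

  destinationSum-compose₀ : ∀ {x y} → Homog 2 x → Homog 2 y → ∀ w →
    destinationSum serDest (compose x 0 y) w ≈ pairing (labels x) (λ a → destSum∘₀ a (labels y) w)
  destinationSum-compose₀ {[]} [] y-binary w = ≈-refl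
  destinationSum-compose₀ {(α , s) ∷ x} {y} (s-binary ∷ x-binary) y-binary w = begin
    destinationSum serDest (graftAll y ++ compose x 0 y) w
      ≈⟨ pairing-++ (graftAll y) _ _ ⟩
    destinationSum serDest (graftAll y) w + destinationSum serDest (compose x 0 y) w
      ≈⟨ +-cong (graftAll-sum y-binary) (destinationSum-compose₀ x-binary y-binary w) ⟩
    α * destSum∘₀ (rootOf s) (labels y) w + pairing (labels x) (λ a → destSum∘₀ a (labels y) w) ∎
    where
    graftAll : Comb → Comb
    graftAll = map (λ q → α * proj₁ q , graft s 0 (proj₂ q))

    graftAll-sum : ∀ {z} → Homog 2 z → destinationSum serDest (graftAll z) w ≈ α * destSum∘₀ (rootOf s) (labels z) w
    graftAll-sum {[]} [] = ≈-sym (zeroʳ α)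
    graftAll-sum {(β , t) ∷ z} (t-binary ∷ z-binary) = begin
      (α * β) * ⟦ serDest (graft s 0 t) ≟V w ⟧ + destinationSum serDest (graftAll z) w
        ≈⟨ +-cong (*-congˡ (reflexive (cong (λ v → ⟦ v ≟V w ⟧) (serDest-graft₀ {s} {t} s-binary t-binary)))) (graftAll-sum z-binary) ⟩
      (α * β) * ⟦ serDest∘₀ (rootOf s) (toList (rootOf t)) ≟V w ⟧ + α * destSum∘₀ (rootOf s) (labels z) w
        ≈⟨ +-congʳ (*-assoc α β _) ⟩
      α * (β * ⟦ serDest∘₀ (rootOf s) (toList (rootOf t)) ≟V w ⟧) + α * destSum∘₀ (rootOf s) (labels z) w
        ≈⟨ distribˡ α _ _ ⟨
      α * destSum∘₀ (rootOf s) (labels ((β , t) ∷ z)) w ∎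

module Transport {c ℓ} (F : Field c ℓ) (k : ℕ) (iso : Signaletic.MessyParallel≅MessySeries F k) where
  open Field F renaming (refl to ≈-refl; sym to ≈-sym; trans to ≈-trans)
  open import Relation.Binary.Reasoning.Setoid setoid
  open import Algebra.Properties.Ring ring using (x+x≈x⇒x≈0)
  open LinearCombination F
  open Signaletic F k
  open Quotient F k
  open SeriesArity2 F k using (_∘₀_≈0; destSum∘₀)
  open SeriesTrees F k using (labels; destinationSum-compose₀)
  open OperadIso iso

  φ[]≈0 : ∀ n w → destinationSum serDest (φ n []) w ≈ 0#
  φ[]≈0 n w = x+x≈x⇒x≈0 _ (≈-sym (≈-trans (Rel⇒SameSums (φ-add {n} [] []) w) (pairing-++ (φ n []) (φ n []) _)))

  φ-composite : ∀ {x y} → Homog 2 x → Homog 2 y → ∀ w →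
    destinationSum serDest (φ 3 (compose x 0 y)) w ≈ pairing (labels (φ 2 x)) (λ a → destSum∘₀ a (labels (φ 2 y)) w)
  φ-composite x-binary y-binary w =
    ≈-trans (Rel⇒SameSums (φ-comp 0 (s≤s z≤n) x-binary y-binary) w)
            (destinationSum-compose₀ (φ-homog x-binary) (φ-homog y-binary) w)

  φ-preserves-zero-composite : ∀ {x y} → Homog 2 x → Homog 2 y → Homog 3 (compose x 0 y) →
    ParRel 3 (compose x 0 y) [] → labels (φ 2 x) ∘₀ labels (φ 2 y) ≈0
  φ-preserves-zero-composite {x} {y} x-binary y-binary xy-ternary xy≈0 w = begin
    pairing (labels (φ 2 x)) (λ a → destSum∘₀ a (labels (φ 2 y)) w) ≈⟨ φ-composite x-binary y-binary w ⟨
    destinationSum serDest (φ 3 (compose x 0 y)) w     ≈⟨ Rel⇒SameSums (φ-cong xy-ternary [] xy≈0) w ⟩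
    destinationSum serDest (φ 3 []) w                  ≈⟨ φ[]≈0 3 w ⟩
    0#                                                 ∎

  φ-reflects-zero-composite : ∀ {x y} → Homog 2 x → Homog 2 y → Homog 3 (compose x 0 y) →
    ¬ ParRel 3 (compose x 0 y) [] → ¬ labels (φ 2 x) ∘₀ labels (φ 2 y) ≈0
  φ-reflects-zero-composite x-binary y-binary xy-ternary xy≉0 φx∘φy≈0 =
    xy≉0 (φ-inj xy-ternary [] (SameSums⇒Rel serDest (φ-homog xy-ternary) (φ-homog []) λ w →
      ≈-trans (φ-composite x-binary y-binary w) (≈-trans (φx∘φy≈0 w) (≈-sym (φ[]≈0 3 w)))))

corollary6p17 : ∀ {c ℓ : Level} (F : Field c ℓ) (k : ℕ) → 2 ≤ k →
    ¬ Signaletic.MessyParallel≅MessySeries F k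
corollary6p17 F (suc (suc k′)) (s≤s (s≤s z≤n)) iso =
  no-crossed-zero-composites
    {image ⟨ only₀≺ ⟩} {image ⟨ only₁≺ ⟩} {image (all≺ ⟨−⟩ only₁≻)} {image (all≺ ⟨−⟩ only₀≻)}
    (zero-composite only₀≺ all≺ only₁≻ only₀≺-ignores-car₁)
    (zero-composite only₁≺ all≺ only₀≻ only₁≺-ignores-car₀)
    (nonzero-composite only₀≺ all≺ only₀≻ only₀≺-sees-car₀)
    (nonzero-composite only₁≺ all≺ only₁≻ only₁≺-sees-car₁)
  where
  open ParallelWitnesses k′
  open Signaletic F (suc (suc k′)) using (Comb)
  open Differences F (suc (suc k′))
  open SeriesArity2 F (suc (suc k′)) using (LabelComb; _∘₀_≈0; no-crossed-zero-composites)
  open SeriesTrees F (suc (suc k′)) using (labels)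
  open Transport F (suc (suc k′)) iso
  open Signaletic.OperadIso iso using (φ)

  image : Comb → LabelComb
  image x = labels (φ 2 x)

  zero-composite : ∀ r L L′ → parDest (node r (cherry L) leaf) ≡ parDest (node r (cherry L′) leaf) →
    image ⟨ r ⟩ ∘₀ image (L ⟨−⟩ L′) ≈0
  zero-composite r L L′ same = φ-preserves-zero-composite (refl ∷ []) (refl ∷ refl ∷ []) (refl ∷ refl ∷ [])
    (∘₀⟨−⟩≈0 parDest r L L′ same)

  nonzero-composite : ∀ r L L′ → parDest (node r (cherry L) leaf) ≢ parDest (node r (cherry L′) leaf) →
    ¬ image ⟨ r ⟩ ∘₀ image (L ⟨−⟩ L′) ≈0
  nonzero-composite r L L′ differ = φ-reflects-zero-composite (refl ∷ []) (refl ∷ refl ∷ []) (refl ∷ refl ∷ [])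
    (∘₀⟨−⟩≉0 parDest r L L′ differ)
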